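{- Let $t$ be a positive integer and let $A,S_1,\dots,S_t$ be non-empty finite sets. Let $f:A\to A$ be a map, let $\varphi_i:A\to S_i$ and $\psi_i:A\to S_i$ ($1\le i\le t$) be surjective maps, and let $h_i:S_i\to S_i$ ($1\le i\le t$) be maps, such that the maps $\varphi:A\to S_1\times\cdots\times S_t$, $\varphi(a)=(\varphi_1(a),\dots,\varphi_t(a))$, and $\psi:A\to S_1\times\cdots\times S_t$, $\psi(a)=(\psi_1(a),\dots,\psi_t(a))$, are injective, and $\psi_i\circ f=h_i\circ\varphi_i$ for $1\le i\le t$ (so that $\psi\circ f=(h_1,\dots,h_t)\circ\varphi$). Then $f$ is a bijection if and only if $h_1,\dots,h_t$ are all injective. Furthermore, if $f$ is a bijection, $\varphi^{ -1}:S_1\times\cdots\times S_t\to A$ is a left inverse of $\varphi$, and $h_i^{ -1}$ is the compositional inverse of $h_i$ for $1\le i\le t$, then $$f^{ -1}=\varphi^{ -1}\circ(h_1^{ -1},\dots,h_t^{ -1})\circ\psi.$$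
   Context: A left inverse of a map $g:X\to Y$ is a map $g':Y\to X$ with $g'\circ g=\mathrm{id}_X$. $(h_1,\dots,h_t)$ denotes the map $(s_1,\dots,s_t)\mapsto(h_1(s_1),\dots,h_t(s_t))$. -}

module Defs where

open import Data.Nat using (ℕ; zero; suc)
open import Data.Fin using (Fin; zero; suc)
open import Data.Unit using (⊤; tt)
open import Data.Product using (_×_; _,_)
open import Function using (_∘_)

-- The cartesian product S₁ × ⋯ × Sₜ of a Fin t-indexed family of types,
-- built as nested pairs so that equality of tuples is componentwise ≡.
Prod : (t : ℕ) → (Fin t → Set) → Set
Prod zero    S = ⊤
Prod (suc t) S = S zero × Prod t (S ∘ suc)

tuple : {A : Set} (t : ℕ) {S : Fin t → Set} → ((i : Fin t) → A → S i) → A → Prod t S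
tuple zero    φ a = tt
tuple (suc t) φ a = φ zero a , tuple t (λ i → φ (suc i)) a

mapP : (t : ℕ) {S : Fin t → Set} → ((i : Fin t) → S i → S i) → Prod t S → Prod t S
mapP zero    h tt       = tt
mapP (suc t) h (x , xs) = h zero x , mapP t (λ i → h (suc i)) xs

{-# OPTIONS --safe #-}
-- If every h_i is injective, injectivity of φ makes f injective; if f is onto, so is each
-- h_i ∘ φ_i = ψ_i ∘ f, hence h_i.  On finite sets injective and surjective endomaps coincide.
-- For the inverse, φ(f⁻¹ a) = h⁻¹(h(φ(f⁻¹ a))) = h⁻¹(ψ(f(f⁻¹ a))) = h⁻¹(ψ a).
module Submission where

open import Defs
open import Data.Nat using (ℕ; _≤_; zero; suc)
open import Data.Nat.Properties using (n<1+n)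
open import Data.Fin using (Fin; zero; suc; punchOut)
open import Data.Fin.Properties using (<⇒notInjective; punchOut-injective; any?; _≟_)
open import Data.Product using (_×_; _,_; proj₁; proj₂)
open import Function using (_∘_)
open import Function.Definitions using (Injective; Surjective; StrictlySurjective; Bijective)
open import Function.Bundles using (_⇔_; mk⇔)
open import Function.Consequences.Propositional
  using (surjective⇒strictlySurjective; strictlySurjective⇒surjective)
open import Relation.Binary.PropositionalEquality
  using (_≡_; _≢_; refl; sym; trans; cong; cong₂; module ≡-Reasoning)
open import Relation.Nullary using (yes; no)
open import Data.Empty using (⊥-elim)

injective⇒strictlySurjective : ∀ {n} {f : Fin n → Fin n} →
                               Injective _≡_ _≡_ f → StrictlySurjective _≡_ f
injective⇒strictlySurjective {n = zero}  f-inj ()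
injective⇒strictlySurjective {n = suc n} {f = f} f-inj y with any? (λ x → f x ≟ y)
... | yes hit = hit
... | no miss = ⊥-elim (<⇒notInjective (n<1+n n) punchOut-f-injective)
  where
  y≢f : ∀ x → y ≢ f x
  y≢f x y≡fx = miss (x , sym y≡fx)

  punchOut-f-injective : Injective _≡_ _≡_ (λ x → punchOut (y≢f x))
  punchOut-f-injective {x} {x′} = f-inj ∘ punchOut-injective (y≢f x) (y≢f x′)

strictlySurjective⇒injective : ∀ {n} {f : Fin n → Fin n} →
                               StrictlySurjective _≡_ f → Injective _≡_ _≡_ f
strictlySurjective⇒injective {n} {f} f-surj {x} {x′} fx≡fx′ = begin
  x              ≡⟨ sym (section-cancelˡ x) ⟩
  section (f x)  ≡⟨ cong section fx≡fx′ ⟩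
  section (f x′) ≡⟨ section-cancelˡ x′ ⟩
  x′             ∎
  where
  open ≡-Reasoning

  section : Fin n → Fin n
  section y = proj₁ (f-surj y)

  section-injective : Injective _≡_ _≡_ section
  section-injective {y} {y′} e =
    trans (sym (proj₂ (f-surj y)))
          (trans (cong f e) (proj₂ (f-surj y′)))

  -- the section is itself onto, being an injective endomap of a finite set
  section-cancelˡ : ∀ x → section (f x) ≡ x
  section-cancelˡ x with injective⇒strictlySurjective section-injective x
  ... | y , refl = cong section (proj₂ (f-surj y))

tuple-cong : ∀ {A B : Set} t {S : Fin t → Set} (φ : (i : Fin t) → A → S i) (φ′ : (i : Fin t) → B → S i)
             {a : A} {b : B} →
             (∀ i → φ i a ≡ φ′ i b) → tuple t φ a ≡ tuple t φ′ b
tuple-cong zero    φ φ′ eq = refl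
tuple-cong (suc t) φ φ′ eq = cong₂ _,_ (eq zero) (tuple-cong t _ _ (eq ∘ suc))

mapP-tuple : ∀ {A : Set} t {S : Fin t → Set} (h : (i : Fin t) → S i → S i)
             (φ : (i : Fin t) → A → S i) (a : A) →
             mapP t h (tuple t φ a) ≡ tuple t (λ i → h i ∘ φ i) a
mapP-tuple zero    h φ a = refl
mapP-tuple (suc t) h φ a = cong (h zero (φ zero a) ,_) (mapP-tuple t _ _ a)

mapP-inverseˡ : ∀ t {S : Fin t → Set} (h h⁻¹ : (i : Fin t) → S i → S i) →
                (∀ i x → h⁻¹ i (h i x) ≡ x) → ∀ x → mapP t h⁻¹ (mapP t h x) ≡ x
mapP-inverseˡ zero    h h⁻¹ inv _        = refl
mapP-inverseˡ (suc t) h h⁻¹ inv (x , xs) =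
  cong₂ _,_ (inv zero x) (mapP-inverseˡ t _ _ (inv ∘ suc) xs)

module CommutingSquare
  {A B : Set} (t : ℕ) {S : Fin t → Set}
  (f : A → B) (φ : (i : Fin t) → A → S i) (ψ : (i : Fin t) → B → S i)
  (h : (i : Fin t) → S i → S i)
  (commutes : ∀ i a → ψ i (f a) ≡ h i (φ i a))
  where

  tuple-commutes : ∀ a → tuple t ψ (f a) ≡ mapP t h (tuple t φ a)
  tuple-commutes a = trans (tuple-cong t ψ _ (λ i → commutes i a)) (sym (mapP-tuple t h φ a))

  f-injective : Injective _≡_ _≡_ (tuple t φ) → (∀ i → Injective _≡_ _≡_ (h i)) →
              Injective _≡_ _≡_ f
  f-injective φ-inj h-inj {a} {b} fa≡fb = φ-inj (tuple-cong t φ φ φa≡φb)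
    where
    φa≡φb : ∀ i → φ i a ≡ φ i b
    φa≡φb i = h-inj i (begin
      h i (φ i a) ≡⟨ sym (commutes i a) ⟩
      ψ i (f a)   ≡⟨ cong (ψ i) fa≡fb ⟩
      ψ i (f b)   ≡⟨ commutes i b ⟩
      h i (φ i b) ∎)
      where open ≡-Reasoning

  h-strictlySurjective : StrictlySurjective _≡_ f → ∀ i → StrictlySurjective _≡_ (ψ i) →
                         StrictlySurjective _≡_ (h i)
  h-strictlySurjective f-surj i ψᵢ-surj y with ψᵢ-surj y
  ... | b , ψᵢb≡y with f-surj b
  ...   | a , refl = φ i a , trans (sym (commutes i a)) ψᵢb≡y

  f⁻¹-formula : (φ⁻¹ : Prod t S → A) → (∀ a → φ⁻¹ (tuple t φ a) ≡ a) →
                (h⁻¹ : (i : Fin t) → S i → S i) → (∀ i x → h⁻¹ i (h i x) ≡ x) →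
                (f⁻¹ : B → A) → (∀ b → f (f⁻¹ b) ≡ b) →
                ∀ b → f⁻¹ b ≡ φ⁻¹ (mapP t h⁻¹ (tuple t ψ b))
  f⁻¹-formula φ⁻¹ φ⁻¹-inverseˡ h⁻¹ h⁻¹-inverseˡ f⁻¹ f⁻¹-inverseʳ b = begin
    f⁻¹ b                                           ≡⟨ sym (φ⁻¹-inverseˡ (f⁻¹ b)) ⟩
    φ⁻¹ (tuple t φ (f⁻¹ b))                         ≡⟨ cong φ⁻¹ (sym (mapP-inverseˡ t h h⁻¹ h⁻¹-inverseˡ _)) ⟩
    φ⁻¹ (mapP t h⁻¹ (mapP t h (tuple t φ (f⁻¹ b)))) ≡⟨ cong (φ⁻¹ ∘ mapP t h⁻¹) (sym (tuple-commutes (f⁻¹ b))) ⟩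
    φ⁻¹ (mapP t h⁻¹ (tuple t ψ (f (f⁻¹ b))))        ≡⟨ cong (φ⁻¹ ∘ mapP t h⁻¹ ∘ tuple t ψ) (f⁻¹-inverseʳ b) ⟩
    φ⁻¹ (mapP t h⁻¹ (tuple t ψ b))                  ∎
    where open ≡-Reasoning

corollary5p3 :
    (t : ℕ) → 1 ≤ t →
    (n : ℕ) → 1 ≤ n →
    (s : Fin t → ℕ) → ((i : Fin t) → 1 ≤ s i) →
    (f : Fin n → Fin n) →
    (φ ψ : (i : Fin t) → Fin n → Fin (s i)) →
    (h : (i : Fin t) → Fin (s i) → Fin (s i)) →
    ((i : Fin t) → Surjective _≡_ _≡_ (φ i)) →
    ((i : Fin t) → Surjective _≡_ _≡_ (ψ i)) →
    Injective _≡_ _≡_ (tuple t φ) →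
    Injective _≡_ _≡_ (tuple t ψ) →
    ((i : Fin t) → (a : Fin n) → ψ i (f a) ≡ h i (φ i a)) →
    (Bijective _≡_ _≡_ f ⇔ ((i : Fin t) → Injective _≡_ _≡_ (h i)))
    ×
    (Bijective _≡_ _≡_ f →
     (φinv : Prod t (λ i → Fin (s i)) → Fin n) →
     ((a : Fin n) → φinv (tuple t φ a) ≡ a) →
     (hinv : (i : Fin t) → Fin (s i) → Fin (s i)) →
     ((i : Fin t) → (x : Fin (s i)) → hinv i (h i x) ≡ x) →
     ((i : Fin t) → (x : Fin (s i)) → h i (hinv i x) ≡ x) →
     (finv : Fin n → Fin n) →
     ((a : Fin n) → finv (f a) ≡ a) →
     ((a : Fin n) → f (finv a) ≡ a) →
     (a : Fin n) → finv a ≡ φinv (mapP t hinv (tuple t ψ a)))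
corollary5p3 t _ n _ s _ f φ ψ h _ ψ-surj φ-inj _ commutes =
    mk⇔ bijective⇒h-injective h-injective⇒bijective
  , λ _ φinv φinv-inverseˡ hinv hinv-inverseˡ _ finv _ f-finv →
      f⁻¹-formula φinv φinv-inverseˡ hinv hinv-inverseˡ finv f-finv
  where
  open CommutingSquare t f φ ψ h commutes

  bijective⇒h-injective : Bijective _≡_ _≡_ f → ∀ i → Injective _≡_ _≡_ (h i)
  bijective⇒h-injective (_ , f-surj) i = strictlySurjective⇒injective
    (h-strictlySurjective (surjective⇒strictlySurjective f-surj) i
                          (surjective⇒strictlySurjective (ψ-surj i)))

  h-injective⇒bijective : (∀ i → Injective _≡_ _≡_ (h i)) → Bijective _≡_ _≡_ f
  h-injective⇒bijective h-inj =
    f-inj , strictlySurjective⇒surjective (injective⇒strictlySurjective f-inj)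
    where
    f-inj : Injective _≡_ _≡_ f
    f-inj = f-injective φ-inj h-inj
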